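{- Let $e,f$ be two disjoint sequences of nonzero vectors in $\mathbb N^d$ with $|e|=|f|$, $\Delta\geq0$ on $[0,1]^d$ and $\Delta\geq1$ on $\mathcal D$, and let $p$ be a prime. For all $s\in\mathbb N$, $\mathbf a\in\{0,\dots,p^{s+1}-1\}^d$ and $\mathbf m\in\mathbb N^d$, we have $\eta_{s+1}(\mathbf a,\mathbf m)\geq\mu(\mathbf m)$ and $$v_p\Big(\frac{\mathcal Q(\mathbf a+\mathbf mp^{s+1})}{g(\mathbf m)}\Big)\geq\sum_{\ell=1}^{s+1}\Delta\big(\{\mathbf a/p^\ell\}\big).$$
   Context: For $e=(\mathbf e_1,\dots,\mathbf e_{q_1})$, $f=(\mathbf f_1,\dots,\mathbf f_{q_2})$: $\mathcal Q(\mathbf n)=\prod_i(\mathbf e_i\cdot\mathbf n)!/\prod_j(\mathbf f_j\cdot\mathbf n)!$; $\Delta(\mathbf x)=\sum_i\lfloor\mathbf e_i\cdot\mathbf x\rfloor-\sum_j\lfloor\mathbf f_j\cdot\mathbf x\rfloor$; $\mathcal D$ is the set of $\mathbf x\in[0,1)^d$ with $\mathbf d\cdot\mathbf x\geq1$ for some $\mathbf d\in\{\mathbf e_1,\dots,\mathbf f_{q_2}\}$; $\{\cdot\}$ is coordinatewise fractional part. $\mu(\mathbf m)=\sum_{\ell\geq1}\mathbf 1_{\mathcal D}(\{\mathbf m/p^\ell\})$, $g(\mathbf m)=p^{\mu(\mathbf m)}$, and for $\mathbf a\in\{0,\dots,p^t-1\}^d$, $\eta_t(\mathbf a,\mathbf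 m)=\sum_{\ell\geq t+1}\Delta(\{(\mathbf a+\mathbf mp^t)/p^\ell\})$. -}

module Defs where

open import Data.Nat using (ℕ; zero; suc; _!; _+_; _*_; _^_; _≤_; _<_; _≤?_; _<?_; NonZero)
open import Data.Nat.Properties using (m^n≢0; _≟_)
open import Data.Nat.DivMod using (_/_; _%_)
open import Data.Nat.Divisibility using (_∣_; _∣?_)

open import Data.Nat.Primality using (Prime; prime⇒nonZero)
open import Data.Integer as ℤ using (ℤ; +_; 0ℤ)
open import Data.Fin using (Fin)
import Data.Fin as Fin
open import Data.Fin.Properties using (all?; any?)
open import Data.Product using (Σ; ∃; _×_; _,_)
open import Data.Sum using (_⊎_)
open import Relation.Nullary using (Dec; yes; no; does)
open import Relation.Nullary.Decidable using (_×-dec_; _⊎-dec_)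
open import Data.Bool using (if_then_else_)

ΣF : ∀ {n} → (Fin n → ℕ) → ℕ
ΣF {zero}  g = 0
ΣF {suc n} g = g Fin.zero + ΣF (λ i → g (Fin.suc i))

ΠF : ∀ {n} → (Fin n → ℕ) → ℕ
ΠF {zero}  g = 1
ΠF {suc n} g = g Fin.zero * ΠF (λ i → g (Fin.suc i))

ΣZ : ℕ → ℕ → (ℕ → ℤ) → ℤ
ΣZ from zero    g = 0ℤ
ΣZ from (suc k) g = g from ℤ.+ ΣZ (suc from) k g

ΣN : ℕ → ℕ → (ℕ → ℕ) → ℕ
ΣN from zero    g = 0
ΣN from (suc k) g = g from + ΣN (suc from) k g

dot : ∀ {d} → (Fin d → ℕ) → (Fin d → ℕ) → ℕ
dot x y = ΣF (λ k → x k * y k)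

-- p-adic valuation of a natural number n ≥ 1 (for p ≥ 2): the largest v with p^v ∣ n.
-- Implemented by repeated division with fuel (fuel n suffices since n/p < n).
vpAux : ℕ → ℕ → ℕ → ℕ
vpAux zero    p n = 0
vpAux (suc k) p n with n ≟ 0 | p ≤? 1 | p ∣? n
... | no _ | no _ | yes pn = suc (vpAux k p (_∣_.quotient pn))
... | _    | _    | _      = 0

vp : ℕ → ℕ → ℕ
vp p n = vpAux n p n

-- Setup for fixed dimension d and sequences e = (e_1..e_q₁), f = (f_1..f_q₂) in ℕ^d.
-- A rational point x ∈ ℚ^d is represented as x = n / N with n ∈ ℕ^d, N ≥ 1.
module Setup {d q₁ q₂ : ℕ} (e : Fin q₁ → Fin d → ℕ) (f : Fin q₂ → Fin d → ℕ) where

  Δ : (N : ℕ) .{{_ : NonZero N}} → (Fin d → ℕ) → ℤ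
  Δ N n = + ΣF (λ i → dot (e i) n / N) ℤ.- + ΣF (λ j → dot (f j) n / N)

  In𝒟 : (N : ℕ) → (Fin d → ℕ) → Set
  In𝒟 N n = (∀ k → n k < N)
          × ((∃ λ i → N ≤ dot (e i) n) ⊎ (∃ λ j → N ≤ dot (f j) n))

  In𝒟? : (N : ℕ) → (n : Fin d → ℕ) → Dec (In𝒟 N n)
  In𝒟? N n = all? (λ k → n k <? N)
             ×-dec (any? (λ i → N ≤? dot (e i) n) ⊎-dec any? (λ j → N ≤? dot (f j) n))

  1𝒟 : (N : ℕ) → (Fin d → ℕ) → ℕ
  1𝒟 N n = if does (In𝒟? N n) then 1 else 0

  -- Cutoff beyond which all terms of the series defining μ and η vanish
  -- (for ℓ > B(x) we have x_k < p^ℓ and e_i·x, f_j·x < p^ℓ).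
  B : (Fin d → ℕ) → ℕ
  B x = ΣF x + ΣF (λ i → dot (e i) x) + ΣF (λ j → dot (f j) x)

  module AtPrime (p : ℕ) (pr : Prime p) where
    private
      instance
        p≢0 : NonZero p
        p≢0 = prime⇒nonZero pr

    -- numerator of {x / p^ℓ} over denominator p^ℓ
    fracN : ℕ → (Fin d → ℕ) → Fin d → ℕ
    fracN ℓ x k = _%_ (x k) (p ^ ℓ) {{m^n≢0 p ℓ}}

    Δfrac : ℕ → (Fin d → ℕ) → ℤ
    Δfrac ℓ x = Δ (p ^ ℓ) {{m^n≢0 p ℓ}} (fracN ℓ x)

    -- μ(m) = Σ_{ℓ ≥ 1} 1_𝒟({m/p^ℓ})   (terms with ℓ > B m vanish)
    μ : (Fin d → ℕ) → ℕ
    μ m = ΣN 1 (B m) (λ ℓ → 1𝒟 (p ^ ℓ) (fracN ℓ m))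

    shift : ℕ → (Fin d → ℕ) → (Fin d → ℕ) → Fin d → ℕ
    shift t a m k = a k + m k * p ^ t

    -- η_t(a,m) = Σ_{ℓ ≥ t+1} Δ({(a + m p^t)/p^ℓ})   (terms with ℓ > B(a + m p^t) vanish)
    η : ℕ → (Fin d → ℕ) → (Fin d → ℕ) → ℤ
    η t a m = ΣZ (suc t) (suc (B (shift t a m))) (λ ℓ → Δfrac ℓ (shift t a m))

    -- v_p( Q(n) / g(m) ) where Q(n) = Π_i (e_i·n)! / Π_j (f_j·n)!, g(m) = p^{μ(m)}
    vpQ/g : (Fin d → ℕ) → (Fin d → ℕ) → ℤ
    vpQ/g n m = + vp p (ΠF (λ i → (dot (e i) n) !))
                ℤ.- + vp p (ΠF (λ j → (dot (f j) n) !) * p ^ μ m)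

module Submission where

-- Proof plan.  Write n = a + m p^t with a < p^t coordinatewise (t = s + 1 in lemma14).
--
-- * Legendre's formula v_p(x!) = Σ_{ℓ=1}^{L} ⌊x/p^ℓ⌋ (for x < p^L) turns v_p(Q(n)) into
--   Σ_{ℓ=1}^{L} Δ(n/p^ℓ) for L large.
-- * Because the column sums of e and f agree, Δ is 1-periodic: Δ(x/N) = Δ({x/N}).  Hence
--   v_p(Q(n)) = Σ_{ℓ ≤ t} Δ({n/p^ℓ}) + η_t(a,m), and {n/p^ℓ} = {a/p^ℓ} for ℓ ≤ t, so
--   v_p(Q(n)/g(m)) = Σ_{ℓ=1}^{t} Δ({a/p^ℓ}) + η_t(a,m) − μ(m).
-- * Coordinatewise, p^t · {m/p^ℓ} ≤ {n/p^{ℓ+t}}; so if {m/p^ℓ} ∈ 𝒟 then {n/p^{ℓ+t}} ∈ 𝒟, and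
--   by the hypotheses on Δ every term of η_t(a,m) dominates the corresponding term of μ(m).
--   This gives η_t(a,m) ≥ μ(m), and then the valuation bound from the identity above.

open import Defs
open import Data.Nat using (ℕ; suc; _^_; _≤_; _<_; NonZero)
open import Data.Nat.Primality using (Prime)
open import Data.Integer as ℤ using (+_; 0ℤ; 1ℤ)
open import Data.Fin using (Fin)
open import Data.Product using (_×_; _,_)
open import Relation.Nullary using (¬_)
open import Relation.Binary.PropositionalEquality using (_≡_)

open import Data.Nat using (zero; _+_; _*_; _∸_; _!; z≤n; s≤s; >-nonZero; ≢-nonZero; ≢-nonZero⁻¹; nonTrivial⇒n>1)
open import Data.Nat.Properties
open import Data.Nat.DivMod
open import Data.Nat.Divisibility
open import Data.Nat.Primality using (prime⇒nonTrivial; euclidsLemma)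
open import Data.Nat.Induction using (<-rec)
open import Data.Nat.Tactic.RingSolver using (solve-∀)
import Data.Fin as Fin
open import Data.Integer using (ℤ)
import Data.Integer.Properties as ℤP
import Data.Integer.Tactic.RingSolver as ℤSolver
open import Data.Product using (∃; ∃₂)
open import Data.Sum using (inj₁; inj₂)
import Data.Sum as Sum
open import Data.Bool using (if_then_else_)
open import Data.Empty using (⊥-elim)
open import Relation.Nullary using (Dec; yes; no; does)
open import Relation.Binary.PropositionalEquality
  using (_≢_; refl; sym; trans; cong; cong₂; subst; subst₂; module ≡-Reasoning)

ΣF-cong : ∀ {n} {g h : Fin n → ℕ} → (∀ i → g i ≡ h i) → ΣF g ≡ ΣF h
ΣF-cong {zero}  g≡h = refl
ΣF-cong {suc n} g≡h = cong₂ _+_ (g≡h Fin.zero) (ΣF-cong (λ i → g≡h (Fin.suc i)))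

ΣF-mono : ∀ {n} {g h : Fin n → ℕ} → (∀ i → g i ≤ h i) → ΣF g ≤ ΣF h
ΣF-mono {zero}  g≤h = z≤n
ΣF-mono {suc n} g≤h = +-mono-≤ (g≤h Fin.zero) (ΣF-mono (λ i → g≤h (Fin.suc i)))

ΣF-term≤ : ∀ {n} (g : Fin n → ℕ) i → g i ≤ ΣF g
ΣF-term≤ g Fin.zero    = m≤m+n _ _
ΣF-term≤ g (Fin.suc i) = ≤-trans (ΣF-term≤ (λ i → g (Fin.suc i)) i) (m≤n+m _ _)

+-interchange : ∀ a b c d → (a + b) + (c + d) ≡ (a + c) + (b + d)
+-interchange = solve-∀

ΣF-+ : ∀ {n} (g h : Fin n → ℕ) → ΣF (λ i → g i + h i) ≡ ΣF g + ΣF h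
ΣF-+ {zero}  g h = refl
ΣF-+ {suc n} g h =
  trans (cong (_+_ (g Fin.zero + h Fin.zero)) (ΣF-+ (λ i → g (Fin.suc i)) (λ i → h (Fin.suc i))))
        (+-interchange (g Fin.zero) (h Fin.zero) _ _)

ΣF-*ʳ : ∀ {n} (g : Fin n → ℕ) c → ΣF (λ i → g i * c) ≡ ΣF g * c
ΣF-*ʳ {zero}  g c = refl
ΣF-*ʳ {suc n} g c =
  trans (cong (_+_ (g Fin.zero * c)) (ΣF-*ʳ (λ i → g (Fin.suc i)) c))
        (sym (*-distribʳ-+ c (g Fin.zero) _))

ΣF-zero : ∀ {n} → ΣF {n} (λ _ → 0) ≡ 0
ΣF-zero {zero}  = refl
ΣF-zero {suc n} = ΣF-zero {n}

ΣF-swap : ∀ {n m} (g : Fin n → Fin m → ℕ) →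
          ΣF (λ i → ΣF (λ k → g i k)) ≡ ΣF (λ k → ΣF (λ i → g i k))
ΣF-swap {zero}  {m} g = sym (ΣF-zero {m})
ΣF-swap {suc n}     g =
  trans (cong (_+_ (ΣF (g Fin.zero))) (ΣF-swap (λ i → g (Fin.suc i))))
        (sym (ΣF-+ (g Fin.zero) (λ k → ΣF (λ i → g (Fin.suc i) k))))

ΣN-cong : ∀ from len {g h : ℕ → ℕ} → (∀ ℓ → g ℓ ≡ h ℓ) → ΣN from len g ≡ ΣN from len h
ΣN-cong from zero      g≡h = refl
ΣN-cong from (suc len) g≡h = cong₂ _+_ (g≡h from) (ΣN-cong (suc from) len g≡h)

ΣN-zero : ∀ from len → ΣN from len (λ _ → 0) ≡ 0
ΣN-zero from zero      = refl
ΣN-zero from (suc len) = ΣN-zero (suc from) len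

ΣN-+ : ∀ from len (g h : ℕ → ℕ) → ΣN from len (λ ℓ → g ℓ + h ℓ) ≡ ΣN from len g + ΣN from len h
ΣN-+ from zero      g h = refl
ΣN-+ from (suc len) g h =
  trans (cong (_+_ (g from + h from)) (ΣN-+ (suc from) len g h)) (+-interchange (g from) (h from) _ _)

ΣF-ΣN : ∀ {n} from len (g : Fin n → ℕ → ℕ) →
        ΣF (λ i → ΣN from len (g i)) ≡ ΣN from len (λ ℓ → ΣF (λ i → g i ℓ))
ΣF-ΣN {zero}  from len g = sym (ΣN-zero from len)
ΣF-ΣN {suc n} from len g =
  trans (cong (_+_ (ΣN from len (g Fin.zero))) (ΣF-ΣN from len (λ i → g (Fin.suc i))))
        (sym (ΣN-+ from len (g Fin.zero) (λ ℓ → ΣF (λ i → g (Fin.suc i) ℓ))))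

-- A 0/1 sequence which is 1 exactly on [1, v] sums to v over any range [1, L] with v ≤ L
-- (stated for ranges [j+1, j+len] to make the induction go through).
ΣN-step : ∀ v (h : ℕ → ℕ) → (∀ ℓ → ℓ ≤ v → h ℓ ≡ 1) → (∀ ℓ → v < ℓ → h ℓ ≡ 0) →
          ∀ j len → v ≤ j + len → ΣN (suc j) len h ≡ v ∸ j
ΣN-step v h h≡1 h≡0 j zero v≤j+0 = sym (m≤n⇒m∸n≡0 (subst (v ≤_) (+-identityʳ j) v≤j+0))
ΣN-step v h h≡1 h≡0 j (suc len) v≤ =
  trans (cong (_+_ (h (suc j))) rest) (first-term (suc j ≤? v))
  where
  rest : ΣN (suc (suc j)) len h ≡ v ∸ suc j
  rest = ΣN-step v h h≡1 h≡0 (suc j) len (subst (v ≤_) (+-suc j len) v≤)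
  first-term : Dec (suc j ≤ v) → h (suc j) + (v ∸ suc j) ≡ v ∸ j
  first-term (yes j<v) = trans (cong (_+ (v ∸ suc j)) (h≡1 (suc j) j<v)) (sym (+-∸-assoc 1 j<v))
  first-term (no j≮v)  = trans (cong₂ _+_ (h≡0 (suc j) (≰⇒> j≮v)) (m≤n⇒m∸n≡0 (m≤n⇒m≤1+n v≤j)))
                               (sym (m≤n⇒m∸n≡0 v≤j))
    where
    v≤j : v ≤ j
    v≤j = ≤-pred (≰⇒> j≮v)

ΣZ-cong : ∀ from len {g h : ℕ → ℤ} → (∀ ℓ → from ≤ ℓ → ℓ < from + len → g ℓ ≡ h ℓ) →
          ΣZ from len g ≡ ΣZ from len h
ΣZ-cong from zero      g≡h = refl
ΣZ-cong from (suc len) g≡h =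
  cong₂ ℤ._+_ (g≡h from ≤-refl (subst (from <_) (sym (+-suc from len)) (s≤s (m≤m+n from len))))
              (ΣZ-cong (suc from) len (λ ℓ from<ℓ ℓ< →
                 g≡h ℓ (≤-trans (n≤1+n from) from<ℓ) (subst (ℓ <_) (sym (+-suc from len)) ℓ<)))

ΣZ-split : ∀ a b from (g : ℕ → ℤ) → ΣZ from (a + b) g ≡ ΣZ from a g ℤ.+ ΣZ (a + from) b g
ΣZ-split zero    b from g = sym (ℤP.+-identityˡ _)
ΣZ-split (suc a) b from g =
  trans (cong (ℤ._+_ (g from)) (trans (ΣZ-split a b (suc from) g)
                                   (cong (λ z → ΣZ (suc from) a g ℤ.+ ΣZ z b g) (+-suc a from))))
        (sym (ℤP.+-assoc (g from) _ _))

ΣN-ΣN≡ΣZ : ∀ from len (g h : ℕ → ℕ) →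
           + ΣN from len g ℤ.- + ΣN from len h ≡ ΣZ from len (λ ℓ → + g ℓ ℤ.- + h ℓ)
ΣN-ΣN≡ΣZ from zero      g h = refl
ΣN-ΣN≡ΣZ from (suc len) g h =
  trans (cong₂ ℤ._-_ (ℤP.pos-+ (g from) (ΣN (suc from) len g)) (ℤP.pos-+ (h from) (ΣN (suc from) len h)))
        (trans (regroup (+ g from) (+ h from) (+ ΣN (suc from) len g) (+ ΣN (suc from) len h))
               (cong (ℤ._+_ (+ g from ℤ.- + h from)) (ΣN-ΣN≡ΣZ (suc from) len g h)))
  where
  regroup : ∀ a b c d → (a ℤ.+ c) ℤ.- (b ℤ.+ d) ≡ (a ℤ.- b) ℤ.+ (c ℤ.- d)
  regroup = ℤSolver.solve-∀

ΣZ-nonneg : ∀ len from (g : ℕ → ℤ) → (∀ ℓ → 0ℤ ℤ.≤ g ℓ) → 0ℤ ℤ.≤ ΣZ from len g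
ΣZ-nonneg zero      from g g≥0 = ℤP.≤-refl
ΣZ-nonneg (suc len) from g g≥0 = ℤP.+-mono-≤ (g≥0 from) (ΣZ-nonneg len (suc from) g g≥0)

ΣN≤ΣZ : ∀ len₁ len₂ from₁ from₂ (h : ℕ → ℕ) (g : ℕ → ℤ) → len₁ ≤ len₂ →
        (∀ j → + h (from₁ + j) ℤ.≤ g (from₂ + j)) → (∀ ℓ → 0ℤ ℤ.≤ g ℓ) →
        + ΣN from₁ len₁ h ℤ.≤ ΣZ from₂ len₂ g
ΣN≤ΣZ zero       len₂       from₁ from₂ h g _ _ g≥0 = ΣZ-nonneg len₂ from₂ g g≥0
ΣN≤ΣZ (suc len₁) (suc len₂) from₁ from₂ h g (s≤s len≤) h≤g g≥0 =
  subst (ℤ._≤ ΣZ from₂ (suc len₂) g) (sym (ℤP.pos-+ (h from₁) _))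
    (ℤP.+-mono-≤ (subst₂ (λ x y → + h x ℤ.≤ g y) (+-identityʳ from₁) (+-identityʳ from₂) (h≤g 0))
                 (ΣN≤ΣZ len₁ len₂ (suc from₁) (suc from₂) h g len≤ shifted g≥0))
  where
  shifted : ∀ j → + h (suc from₁ + j) ℤ.≤ g (suc from₂ + j)
  shifted j = subst₂ (λ x y → + h x ℤ.≤ g y) (+-suc from₁ j) (+-suc from₂ j) (h≤g (suc j))

dot-cong : ∀ {d} (c : Fin d → ℕ) {x y : Fin d → ℕ} → (∀ k → x k ≡ y k) → dot c x ≡ dot c y
dot-cong c x≡y = ΣF-cong (λ k → cong (c k *_) (x≡y k))

dot-mono : ∀ {d} (c : Fin d → ℕ) {x y : Fin d → ℕ} → (∀ k → x k ≤ y k) → dot c x ≤ dot c y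
dot-mono c x≤y = ΣF-mono (λ k → *-monoʳ-≤ (c k) (x≤y k))

dot-*ʳ : ∀ {d} (c x : Fin d → ℕ) t → dot c (λ k → x k * t) ≡ dot c x * t
dot-*ʳ c x t = trans (ΣF-cong (λ k → sym (*-assoc (c k) (x k) t))) (ΣF-*ʳ (λ k → c k * x k) t)

dot-+* : ∀ {d} (c y z : Fin d → ℕ) N → dot c (λ k → y k + z k * N) ≡ dot c y + dot c z * N
dot-+* c y z N =
  trans (ΣF-cong (λ k → trans (*-distribˡ-+ (c k) (y k) (z k * N)) (cong (_+_ (c k * y k)) (sym (*-assoc (c k) (z k) N)))))
        (trans (ΣF-+ (λ k → c k * y k) (λ k → c k * z k * N)) (cong (_+_ (dot c y)) (ΣF-*ʳ (λ k → c k * z k) N)))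

ΣF-dot : ∀ {q d} (c : Fin q → Fin d → ℕ) y → ΣF (λ i → dot (c i) y) ≡ dot (λ k → ΣF (λ i → c i k)) y
ΣF-dot c y = trans (ΣF-swap (λ i k → c i k * y k)) (ΣF-cong (λ k → ΣF-*ʳ (λ i → c i k) (y k)))

dot-/ : ∀ {d} (c x : Fin d → ℕ) N .{{_ : NonZero N}} →
        dot c x / N ≡ dot c (λ k → x k % N) / N + dot c (λ k → x k / N)
dot-/ c x N = begin
  dot c x / N                                              ≡⟨ cong (_/ N) c·x≡ ⟩
  (dot c (λ k → x k % N) + dot c (λ k → x k / N) * N) / N  ≡⟨ +-distrib-/-∣ʳ _ (divides-refl (dot c (λ k → x k / N))) ⟩
  dot c (λ k → x k % N) / N + dot c (λ k → x k / N) * N / N ≡⟨ cong (_+_ (dot c (λ k → x k % N) / N)) (m*n/n≡m _ N) ⟩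
  dot c (λ k → x k % N) / N + dot c (λ k → x k / N)         ∎
  where
  open ≡-Reasoning
  c·x≡ : dot c x ≡ dot c (λ k → x k % N) + dot c (λ k → x k / N) * N
  c·x≡ = trans (dot-cong c (λ k → m≡m%n+[m/n]*n (x k) N)) (dot-+* c (λ k → x k % N) (λ k → x k / N) N)

ΠF≢0 : ∀ {n} (g : Fin n → ℕ) → (∀ i → g i ≢ 0) → ΠF g ≢ 0
ΠF≢0 {zero}  g g≢0 ()
ΠF≢0 {suc n} g g≢0 = ≢-nonZero⁻¹ _ {{m*n≢0 _ _ {{≢-nonZero (g≢0 Fin.zero)}} {{≢-nonZero rest≢0}}}}
  where
  rest≢0 : ΠF (λ i → g (Fin.suc i)) ≢ 0
  rest≢0 = ΠF≢0 (λ i → g (Fin.suc i)) (λ i → g≢0 (Fin.suc i))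

factorial≢0 : ∀ x → x ! ≢ 0
factorial≢0 x = ≢-nonZero⁻¹ (x !) {{x !≢0}}

rotate : ∀ a b c → a * b * c ≡ b * c * a
rotate = solve-∀

indicator : ∀ {a} {A : Set a} → Dec A → ℕ
indicator (yes _) = 1
indicator (no _)  = 0

[r+a*q]/q≡a : ∀ q .{{_ : NonZero q}} r a → r < q → (r + a * q) / q ≡ a
[r+a*q]/q≡a q r a r<q =
  trans (+-distrib-/-∣ʳ r (divides-refl a)) (cong₂ _+_ (m<n⇒m/n≡0 r<q) (m*n/n≡m a q))

1+r+a*[1+r] : ∀ r a → suc (r + a * suc r) ≡ suc a * suc r
1+r+a*[1+r] = solve-∀

suc-/ : ∀ q .{{_ : NonZero q}} n → suc n / q ≡ n / q + indicator (q ∣? suc n)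
suc-/ q n with n % q | n / q | m≡m%n+[m/n]*n n q | m%n<n n q
... | r | a | refl | r<q with m≤n⇒m<n∨m≡n r<q
...   | inj₁ 1+r<q with q ∣? suc (r + a * q)
...     | no _   = trans ([r+a*q]/q≡a q (suc r) a 1+r<q) (sym (+-identityʳ a))
...     | yes q∣ = ⊥-elim (1+n≢0 (trans (sym (m<n⇒m%n≡m 1+r<q)) 1+r%q≡0))
  where
  1+r%q≡0 : suc r % q ≡ 0
  1+r%q≡0 = trans (sym (%-remove-+ʳ (suc r) (divides-refl a))) (n∣m⇒m%n≡0 _ q q∣)
suc-/ q n | r | a | refl | r<q | inj₂ refl with q ∣? suc (r + a * suc r)
... | yes _  = trans (cong (_/ suc r) (1+r+a*[1+r] r a)) (trans (m*n/n≡m (suc a) (suc r)) (+-comm 1 a))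
... | no q∤ = ⊥-elim (q∤ (divides (suc a) (1+r+a*[1+r] r a)))

module Valuation (p : ℕ) (1<p : 1 < p) where

  p≢0 : NonZero p
  p≢0 = >-nonZero (<-trans (s≤s z≤n) 1<p)

  p^≢0 : ∀ ℓ → NonZero (p ^ ℓ)
  p^≢0 ℓ = m^n≢0 p ℓ {{p≢0}}

  ⌊_/p^_⌋ : ℕ → ℕ → ℕ
  ⌊ x /p^ ℓ ⌋ = _/_ x (p ^ ℓ) {{p^≢0 ℓ}}

  -- p^k outgrows k: bounds exponents by the fuel of vp, and cutoffs L by p^L.
  k<p^k : ∀ k → k < p ^ k
  k<p^k zero    = s≤s z≤n
  k<p^k (suc k) = begin
    suc (suc k)      ≤⟨ s≤s (k<p^k k) ⟩
    1 + p ^ k        ≤⟨ +-monoˡ-≤ (p ^ k) (m^n>0 p {{p≢0}} k) ⟩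
    p ^ k + p ^ k    ≡⟨ cong (_+_ (p ^ k)) (sym (+-identityʳ (p ^ k))) ⟩
    2 * p ^ k        ≤⟨ *-monoˡ-≤ (p ^ k) 1<p ⟩
    p * p ^ k        ∎
    where open ≤-Reasoning

  p∤r⇒r≢0 : ∀ {r} → ¬ p ∣ r → r ≢ 0
  p∤r⇒r≢0 p∤r refl = p∤r (p ∣0)

  vpAux-exact : ∀ k fuel n r → k ≤ fuel → n ≡ p ^ k * r → ¬ p ∣ r → vpAux fuel p n ≡ k
  vpAux-exact zero zero n r _ _ _ = refl
  vpAux-exact zero (suc fuel) n r _ n≡r p∤r with n ≟ 0 | p ≤? 1 | p ∣? n
  ... | yes _ | _     | _      = refl
  ... | no _  | yes _ | _      = refl
  ... | no _  | no _  | no _   = refl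
  ... | no _  | no _  | yes p∣n = ⊥-elim (p∤r (subst (p ∣_) (trans n≡r (*-identityˡ r)) p∣n))
  vpAux-exact (suc k) (suc fuel) n r (s≤s k≤fuel) n≡ p∤r with n ≟ 0 | p ≤? 1 | p ∣? n
  ... | yes n≡0 | _     | _   =
    ⊥-elim (≢-nonZero⁻¹ _ {{m*n≢0 (p ^ suc k) r {{p^≢0 (suc k)}} {{≢-nonZero (p∤r⇒r≢0 p∤r)}}}} (trans (sym n≡) n≡0))
  ... | no _    | yes p≤1 | _ = ⊥-elim (<⇒≱ 1<p p≤1)
  ... | no _    | no _  | no p∤n = ⊥-elim (p∤n (divides (p ^ k * r) (trans n≡ (rotate p (p ^ k) r))))
  ... | no _    | no _  | yes (divides q n≡q*p) =
    cong suc (vpAux-exact k fuel q r k≤fuel q≡ p∤r)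
    where
    q≡ : q ≡ p ^ k * r
    q≡ = *-cancelʳ-≡ q (p ^ k * r) p {{p≢0}} (trans (sym n≡q*p) (trans n≡ (rotate p (p ^ k) r)))

  vp-exact : ∀ k r → ¬ p ∣ r → vp p (p ^ k * r) ≡ k
  vp-exact k r p∤r = vpAux-exact k (p ^ k * r) (p ^ k * r) r k≤n refl p∤r
    where
    k≤n : k ≤ p ^ k * r
    k≤n = ≤-trans (<⇒≤ (k<p^k k)) (m≤m*n (p ^ k) r {{≢-nonZero (p∤r⇒r≢0 p∤r)}})

  vp-pow : ∀ k → vp p (p ^ k) ≡ k
  vp-pow k = subst (λ x → vp p x ≡ k) (*-identityʳ (p ^ k)) (vp-exact k 1 p∤1)
    where
    p∤1 : ¬ p ∣ 1
    p∤1 p∣1 = <⇒≱ 1<p (∣⇒≤ p∣1)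

  Factorisation : ℕ → Set
  Factorisation n = ∃₂ λ k r → n ≡ p ^ k * r × ¬ p ∣ r

  factorise : ∀ n → n ≢ 0 → Factorisation n
  factorise = <-rec (λ n → n ≢ 0 → Factorisation n) step
    where
    step : ∀ n → (∀ {m} → m < n → m ≢ 0 → Factorisation m) → n ≢ 0 → Factorisation n
    step n rec n≢0 with p ∣? n
    ... | no p∤n = 0 , n , sym (*-identityˡ n) , p∤n
    ... | yes (divides q n≡q*p) with rec q<n q≢0
      where
      q≢0 : q ≢ 0
      q≢0 refl = n≢0 n≡q*p
      q<n : q < n
      q<n = subst (q <_) (sym n≡q*p) (m<m*n q p {{≢-nonZero q≢0}} 1<p)
    ... | k , r , q≡ , p∤r =
      suc k , r , trans n≡q*p (trans (cong (_* p) q≡) (sym (rotate p (p ^ k) r))) , p∤r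

  vp-spec : ∀ n → n ≢ 0 → ∃ λ r → n ≡ p ^ vp p n * r × ¬ p ∣ r
  vp-spec n n≢0 with factorise n n≢0
  ... | k , r , refl , p∤r rewrite vp-exact k r p∤r = r , refl , p∤r

  ≤⇒p^ℓ∣p^v*r : ∀ {ℓ v} r → ℓ ≤ v → p ^ ℓ ∣ p ^ v * r
  ≤⇒p^ℓ∣p^v*r {ℓ} r ℓ≤v with m≤n⇒∃[o]m+o≡n ℓ≤v
  ... | o , refl = subst (p ^ ℓ ∣_) split (m∣m*n (p ^ o * r))
    where
    split : p ^ ℓ * (p ^ o * r) ≡ p ^ (ℓ + o) * r
    split = trans (sym (*-assoc (p ^ ℓ) (p ^ o) r)) (cong (_* r) (sym (^-distribˡ-+-* p ℓ o)))

  p^ℓ∣p^v*r⇒≤ : ∀ {ℓ v r} → ¬ p ∣ r → p ^ ℓ ∣ p ^ v * r → ℓ ≤ v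
  p^ℓ∣p^v*r⇒≤ {ℓ} {v} {r} p∤r p^ℓ∣ with ℓ ≤? v
  ... | yes ℓ≤v = ℓ≤v
  ... | no ℓ≰v with m≤n⇒∃[o]m+o≡n (≰⇒> ℓ≰v)
  ...   | o , refl = ⊥-elim (p∤r (∣-trans (m∣m*n (p ^ o)) p^[1+o]∣r))
    where
    p^v*p^[1+o]∣p^v*r : p ^ v * p ^ suc o ∣ p ^ v * r
    p^v*p^[1+o]∣p^v*r = subst (_∣ p ^ v * r) (trans (cong (p ^_) (sym (+-suc v o))) (^-distribˡ-+-* p v (suc o))) p^ℓ∣
    p^[1+o]∣r : p ^ suc o ∣ r
    p^[1+o]∣r = *-cancelˡ-∣ (p ^ v) {{p^≢0 v}} p^v*p^[1+o]∣p^v*r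

  vp≡#powers : ∀ x L → x ≢ 0 → x < p ^ L → ΣN 1 L (λ ℓ → indicator (p ^ ℓ ∣? x)) ≡ vp p x
  vp≡#powers x L x≢0 x<p^L with vp-spec x x≢0
  ... | r , x≡ , p∤r = ΣN-step (vp p x) (λ ℓ → indicator (p ^ ℓ ∣? x)) is-one is-zero 0 L v≤L
    where
    is-one : ∀ ℓ → ℓ ≤ vp p x → indicator (p ^ ℓ ∣? x) ≡ 1
    is-one ℓ ℓ≤v with p ^ ℓ ∣? x
    ... | yes _ = refl
    ... | no p^ℓ∤x = ⊥-elim (p^ℓ∤x (subst (p ^ ℓ ∣_) (sym x≡) (≤⇒p^ℓ∣p^v*r r ℓ≤v)))
    is-zero : ∀ ℓ → vp p x < ℓ → indicator (p ^ ℓ ∣? x) ≡ 0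
    is-zero ℓ v<ℓ with p ^ ℓ ∣? x
    ... | no _ = refl
    ... | yes p^ℓ∣x = ⊥-elim (<⇒≱ v<ℓ (p^ℓ∣p^v*r⇒≤ p∤r (subst (p ^ ℓ ∣_) x≡ p^ℓ∣x)))
    v≤L : vp p x ≤ L
    v≤L with vp p x ≤? L
    ... | yes v≤L = v≤L
    ... | no v≰L = ⊥-elim (<⇒≱ x<p^L (begin
      p ^ L             ≤⟨ ^-monoʳ-≤ p {{p≢0}} (<⇒≤ (≰⇒> v≰L)) ⟩
      p ^ vp p x        ≤⟨ m≤m*n (p ^ vp p x) r {{≢-nonZero (p∤r⇒r≢0 p∤r)}} ⟩
      p ^ vp p x * r    ≡⟨ sym x≡ ⟩
      x                 ∎))
      where open ≤-Reasoning

module PrimeValuation (p : ℕ) (pr : Prime p) where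

  open Valuation p (nonTrivial⇒n>1 p {{prime⇒nonTrivial pr}}) public

  -- v_p is additive on nonzero numbers (Euclid's lemma: p ∤ r, p ∤ s ⇒ p ∤ r s).
  vp-* : ∀ x y → x ≢ 0 → y ≢ 0 → vp p (x * y) ≡ vp p x + vp p y
  vp-* x y x≢0 y≢0 with vp-spec x x≢0 | vp-spec y y≢0
  ... | r , x≡ , p∤r | s , y≡ , p∤s =
    subst (λ z → vp p z ≡ vp p x + vp p y) (sym xy≡) (vp-exact (vp p x + vp p y) (r * s) p∤rs)
    where
    interchange : ∀ a b c d → a * c * (b * d) ≡ a * b * (c * d)
    interchange = solve-∀
    xy≡ : x * y ≡ p ^ (vp p x + vp p y) * (r * s)
    xy≡ = trans (cong₂ _*_ x≡ y≡)
          (trans (interchange (p ^ vp p x) (p ^ vp p y) r s)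
                 (cong (_* (r * s)) (sym (^-distribˡ-+-* p (vp p x) (vp p y)))))
    p∤rs : ¬ p ∣ r * s
    p∤rs p∣rs = Sum.[ p∤r , p∤s ] (euclidsLemma r s pr p∣rs)

  vp-ΠF : ∀ {q} (g : Fin q → ℕ) → (∀ i → g i ≢ 0) → vp p (ΠF g) ≡ ΣF (λ i → vp p (g i))
  vp-ΠF {zero}  g g≢0 = vp-pow 0
  vp-ΠF {suc q} g g≢0 =
    trans (vp-* (g Fin.zero) _ (g≢0 Fin.zero) (ΠF≢0 (λ i → g (Fin.suc i)) (λ i → g≢0 (Fin.suc i))))
          (cong (_+_ (vp p (g Fin.zero))) (vp-ΠF (λ i → g (Fin.suc i)) (λ i → g≢0 (Fin.suc i))))

  legendre : ∀ L x → x < p ^ L → vp p (x !) ≡ ΣN 1 L (λ ℓ → ⌊ x /p^ ℓ ⌋)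
  legendre L zero _ =
    trans (vp-pow 0) (sym (trans (ΣN-cong 1 L (λ ℓ → 0/n≡0 (p ^ ℓ) {{p^≢0 ℓ}})) (ΣN-zero 1 L)))
  legendre L (suc x) x<p^L = begin
    vp p (suc x * x !)
      ≡⟨ vp-* (suc x) (x !) (λ ()) (factorial≢0 x) ⟩
    vp p (suc x) + vp p (x !)
      ≡⟨ cong₂ _+_ (sym (vp≡#powers (suc x) L (λ ()) x<p^L)) (legendre L x (<-trans (n<1+n x) x<p^L)) ⟩
    ΣN 1 L divides-suc + ΣN 1 L (λ ℓ → ⌊ x /p^ ℓ ⌋)
      ≡⟨ +-comm (ΣN 1 L divides-suc) _ ⟩
    ΣN 1 L (λ ℓ → ⌊ x /p^ ℓ ⌋) + ΣN 1 L divides-suc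
      ≡⟨ sym (ΣN-+ 1 L (λ ℓ → ⌊ x /p^ ℓ ⌋) divides-suc) ⟩
    ΣN 1 L (λ ℓ → ⌊ x /p^ ℓ ⌋ + divides-suc ℓ)
      ≡⟨ ΣN-cong 1 L (λ ℓ → sym (suc-/ (p ^ ℓ) {{p^≢0 ℓ}} x)) ⟩
    ΣN 1 L (λ ℓ → ⌊ suc x /p^ ℓ ⌋) ∎
    where
    open ≡-Reasoning
    divides-suc : ℕ → ℕ
    divides-suc ℓ = indicator (p ^ ℓ ∣? suc x)

  vp-Π! : ∀ {q} L (g : Fin q → ℕ) → (∀ i → g i < p ^ L) →
          vp p (ΠF (λ i → g i !)) ≡ ΣN 1 L (λ ℓ → ΣF (λ i → ⌊ g i /p^ ℓ ⌋))
  vp-Π! L g g<p^L =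
    trans (vp-ΠF (λ i → g i !) (λ i → factorial≢0 (g i)))
          (trans (ΣF-cong (λ i → legendre L (g i) (g<p^L i))) (ΣF-ΣN 1 L (λ i ℓ → ⌊ g i /p^ ℓ ⌋)))

module Basics {d q₁ q₂ : ℕ} (e : Fin q₁ → Fin d → ℕ) (f : Fin q₂ → Fin d → ℕ) where
  open Setup e f

  Δ-cong : ∀ N .{{_ : NonZero N}} {x y : Fin d → ℕ} → (∀ k → x k ≡ y k) → Δ N x ≡ Δ N y
  Δ-cong N x≡y = cong₂ (λ u v → + u ℤ.- + v) (ΣF-cong (λ i → cong (_/ N) (dot-cong (e i) x≡y)))
                                            (ΣF-cong (λ j → cong (_/ N) (dot-cong (f j) x≡y)))

  dot-e≤B : ∀ i x → dot (e i) x ≤ B x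
  dot-e≤B i x = ≤-trans (ΣF-term≤ (λ i → dot (e i) x) i) (≤-trans (m≤n+m _ (ΣF x)) (m≤m+n _ _))

  dot-f≤B : ∀ j x → dot (f j) x ≤ B x
  dot-f≤B j x = ≤-trans (ΣF-term≤ (λ j → dot (f j) x) j) (m≤n+m _ _)

  B-mono : ∀ {x y : Fin d → ℕ} → (∀ k → x k ≤ y k) → B x ≤ B y
  B-mono x≤y = +-mono-≤ (+-mono-≤ (ΣF-mono x≤y) (ΣF-mono (λ i → dot-mono (e i) x≤y)))
                        (ΣF-mono (λ j → dot-mono (f j) x≤y))

  1𝒟≤ : ∀ N n {z : ℤ} → 0ℤ ℤ.≤ z → (In𝒟 N n → 1ℤ ℤ.≤ z) → + 1𝒟 N n ℤ.≤ z
  1𝒟≤ N n = bound (In𝒟? N n)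
    where
    bound : ∀ {X : Set} (D : Dec X) {z : ℤ} → 0ℤ ℤ.≤ z → (X → 1ℤ ℤ.≤ z) →
            + (if does D then 1 else 0) ℤ.≤ z
    bound (yes x) _   z≥1 = z≥1 x
    bound (no _)  z≥0 _   = z≥0

module Periodicity {d q₁ q₂ : ℕ} (e : Fin q₁ → Fin d → ℕ) (f : Fin q₂ → Fin d → ℕ)
                   (balanced : ∀ k → ΣF (λ i → e i k) ≡ ΣF (λ j → f j k)) where
  open Setup e f

  balanced-dot : ∀ y → ΣF (λ i → dot (e i) y) ≡ ΣF (λ j → dot (f j) y)
  balanced-dot y = trans (ΣF-dot e y) (trans (ΣF-cong (λ k → cong (_* y k) (balanced k))) (sym (ΣF-dot f y)))

  -- Splitting x = (x mod N) + N⌊x/N⌋, the integer parts contribute Σ_i e_i·⌊x/N⌋ to both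
  -- sums of Δ and cancel by balanced-dot.
  Δ-periodic : ∀ N .{{_ : NonZero N}} x → Δ N x ≡ Δ N (λ k → x k % N)
  Δ-periodic N x = begin
    + ΣF (λ i → dot (e i) x / N) ℤ.- + ΣF (λ j → dot (f j) x / N)
      ≡⟨ cong₂ (λ u v → + u ℤ.- + v) (sum-/ e) (trans (sum-/ f) (cong (_+_ (Y)) (sym (balanced-dot q)))) ⟩
    + (X + C) ℤ.- + (Y + C)
      ≡⟨ cong₂ ℤ._-_ (ℤP.pos-+ X C) (ℤP.pos-+ Y C) ⟩
    (+ X ℤ.+ + C) ℤ.- (+ Y ℤ.+ + C)
      ≡⟨ cancel (+ X) (+ Y) (+ C) ⟩
    + X ℤ.- + Y ∎
    where
    open ≡-Reasoning
    r q : Fin d → ℕ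
    r k = x k % N
    q k = x k / N
    X Y C : ℕ
    X = ΣF (λ i → dot (e i) r / N)
    Y = ΣF (λ j → dot (f j) r / N)
    C = ΣF (λ i → dot (e i) q)
    sum-/ : ∀ {q'} (c : Fin q' → Fin d → ℕ) →
            ΣF (λ i → dot (c i) x / N) ≡ ΣF (λ i → dot (c i) r / N) + ΣF (λ i → dot (c i) q)
    sum-/ c = trans (ΣF-cong (λ i → dot-/ (c i) x N)) (ΣF-+ (λ i → dot (c i) r / N) (λ i → dot (c i) q))
    cancel : ∀ a b c → (a ℤ.+ c) ℤ.- (b ℤ.+ c) ≡ a ℤ.- b
    cancel = ℤSolver.solve-∀

module Digits {d q₁ q₂ : ℕ} (e : Fin q₁ → Fin d → ℕ) (f : Fin q₂ → Fin d → ℕ) (p : ℕ) (pr : Prime p) where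
  open Setup e f
  open AtPrime p pr
  open PrimeValuation p pr using (p^≢0)

  frac-shift-low : ∀ t a m ℓ → ℓ ≤ t → ∀ k → fracN ℓ (shift t a m) k ≡ fracN ℓ a k
  frac-shift-low t a m ℓ ℓ≤t k with m≤n⇒∃[o]m+o≡n ℓ≤t
  ... | o , refl = trans (cong (λ z → _%_ z (p ^ ℓ) {{p^≢0 ℓ}}) n≡) ([m+kn]%n≡m%n (a k) (m k * p ^ o) (p ^ ℓ) {{p^≢0 ℓ}})
    where
    reorder : ∀ x y z → x * (y * z) ≡ x * z * y
    reorder = solve-∀
    n≡ : a k + m k * p ^ (ℓ + o) ≡ a k + m k * p ^ o * p ^ ℓ
    n≡ = cong (_+_ (a k)) (trans (cong (m k *_) (^-distribˡ-+-* p ℓ o)) (reorder (m k) (p ^ ℓ) (p ^ o)))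

  -- Above level t, when a < p^t: p^t · {m/p^ℓ} ≤ {n/p^{ℓ+t}} coordinatewise, since
  -- ⌊(n mod p^{ℓ+t}) / p^t⌋ = ⌊n/p^t⌋ mod p^ℓ = m mod p^ℓ.
  frac-shift-high : ∀ t a m → (∀ k → a k < p ^ t) → ∀ ℓ k →
                    fracN ℓ m k * p ^ t ≤ fracN (ℓ + t) (shift t a m) k
  frac-shift-high t a m a<p^t ℓ k =
    subst (_≤ fracN (ℓ + t) n k) (cong (_* p ^ t) top-digits) (m/n*n≤m (fracN (ℓ + t) n k) (p ^ t) {{p^≢0 t}})
    where
    n : Fin d → ℕ
    n = shift t a m
    top-digits : _/_ (fracN (ℓ + t) n k) (p ^ t) {{p^≢0 t}} ≡ fracN ℓ m k
    top-digits = begin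
      _/_ (_%_ (n k) (p ^ (ℓ + t)) {{p^≢0 (ℓ + t)}}) (p ^ t) {{p^≢0 t}}
        ≡⟨ cong (λ z → _/_ z (p ^ t) {{p^≢0 t}})
                (%-congʳ {{p^≢0 (ℓ + t)}} {{m*n≢0 _ _ {{p^≢0 ℓ}} {{p^≢0 t}}}} (^-distribˡ-+-* p ℓ t)) ⟩
      _/_ (_%_ (n k) (p ^ ℓ * p ^ t) {{m*n≢0 _ _ {{p^≢0 ℓ}} {{p^≢0 t}}}}) (p ^ t) {{p^≢0 t}}
        ≡⟨ m%[n*o]/o≡m/o%n (n k) (p ^ ℓ) (p ^ t) {{p^≢0 ℓ}} {{p^≢0 t}} {{m*n≢0 _ _ {{p^≢0 ℓ}} {{p^≢0 t}}}} ⟩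
      _%_ (_/_ (n k) (p ^ t) {{p^≢0 t}}) (p ^ ℓ) {{p^≢0 ℓ}}
        ≡⟨ cong (λ z → _%_ z (p ^ ℓ) {{p^≢0 ℓ}}) ([r+a*q]/q≡a (p ^ t) {{p^≢0 t}} (a k) (m k) (a<p^t k)) ⟩
      fracN ℓ m k ∎
      where open ≡-Reasoning

  𝒟-lift : ∀ t a m → (∀ k → a k < p ^ t) → ∀ ℓ →
           In𝒟 (p ^ ℓ) (fracN ℓ m) → In𝒟 (p ^ (ℓ + t)) (fracN (ℓ + t) (shift t a m))
  𝒟-lift t a m a<p^t ℓ (_ , large) =
    (λ k → m%n<n (shift t a m k) (p ^ (ℓ + t)) {{p^≢0 (ℓ + t)}}) ,
    Sum.map (λ { (i , le) → i , lift (e i) le }) (λ { (j , le) → j , lift (f j) le }) large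
    where
    lift : ∀ c → p ^ ℓ ≤ dot c (fracN ℓ m) → p ^ (ℓ + t) ≤ dot c (fracN (ℓ + t) (shift t a m))
    lift c p^ℓ≤ = begin
      p ^ (ℓ + t)                             ≡⟨ ^-distribˡ-+-* p ℓ t ⟩
      p ^ ℓ * p ^ t                           ≤⟨ *-monoˡ-≤ (p ^ t) p^ℓ≤ ⟩
      dot c (fracN ℓ m) * p ^ t               ≡⟨ sym (dot-*ʳ c (fracN ℓ m) (p ^ t)) ⟩
      dot c (λ k → fracN ℓ m k * p ^ t)       ≤⟨ dot-mono c (frac-shift-high t a m a<p^t ℓ) ⟩
      dot c (fracN (ℓ + t) (shift t a m))     ∎
      where open ≤-Reasoning

module Dominance {d q₁ q₂ : ℕ} (e : Fin q₁ → Fin d → ℕ) (f : Fin q₂ → Fin d → ℕ)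
  (Δ≥0 : ∀ (N : ℕ) .{{_ : NonZero N}} (n : Fin d → ℕ) → (∀ k → n k ≤ N) → 0ℤ ℤ.≤ Setup.Δ e f N n)
  (Δ≥1 : ∀ (N : ℕ) .{{_ : NonZero N}} (n : Fin d → ℕ) → Setup.In𝒟 e f N n → 1ℤ ℤ.≤ Setup.Δ e f N n)
  (p : ℕ) (pr : Prime p) where
  open Setup e f
  open AtPrime p pr
  open PrimeValuation p pr using (p^≢0)
  open Basics e f using (B-mono; 1𝒟≤)
  open Digits e f p pr using (𝒟-lift)

  Δfrac≥0 : ∀ ℓ x → 0ℤ ℤ.≤ Δfrac ℓ x
  Δfrac≥0 ℓ x = Δ≥0 (p ^ ℓ) {{p^≢0 ℓ}} (fracN ℓ x) (λ k → <⇒≤ (m%n<n (x k) (p ^ ℓ) {{p^≢0 ℓ}}))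

  1𝒟≤Δfrac : ∀ t a m → (∀ k → a k < p ^ t) → ∀ ℓ →
             + 1𝒟 (p ^ ℓ) (fracN ℓ m) ℤ.≤ Δfrac (ℓ + t) (shift t a m)
  1𝒟≤Δfrac t a m a<p^t ℓ =
    1𝒟≤ (p ^ ℓ) (fracN ℓ m) (Δfrac≥0 (ℓ + t) (shift t a m))
        (λ m∈𝒟 → Δ≥1 (p ^ (ℓ + t)) {{p^≢0 (ℓ + t)}} _ (𝒟-lift t a m a<p^t ℓ m∈𝒟))

  μ≤η : ∀ t a m → (∀ k → a k < p ^ t) → + μ m ℤ.≤ η t a m
  μ≤η t a m a<p^t =
    ΣN≤ΣZ (B m) (suc (B n)) 1 (suc t) (λ ℓ → 1𝒟 (p ^ ℓ) (fracN ℓ m)) (λ ℓ → Δfrac ℓ n)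
          (m≤n⇒m≤1+n (B-mono m≤n)) termwise (λ ℓ → Δfrac≥0 ℓ n)
    where
    n : Fin d → ℕ
    n = shift t a m
    m≤n : ∀ k → m k ≤ n k
    m≤n k = ≤-trans (m≤m*n (m k) (p ^ t) {{p^≢0 t}}) (m≤n+m _ (a k))
    termwise : ∀ j → + 1𝒟 (p ^ suc j) (fracN (suc j) m) ℤ.≤ Δfrac (suc t + j) n
    termwise j = subst (λ z → + 1𝒟 (p ^ suc j) (fracN (suc j) m) ℤ.≤ Δfrac z n) (cong suc (+-comm j t))
                       (1𝒟≤Δfrac t a m a<p^t (suc j))

module Expansion {d q₁ q₂ : ℕ} (e : Fin q₁ → Fin d → ℕ) (f : Fin q₂ → Fin d → ℕ)
                 (balanced : ∀ k → ΣF (λ i → e i k) ≡ ΣF (λ j → f j k)) (p : ℕ) (pr : Prime p) where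
  open Setup e f
  open AtPrime p pr
  open PrimeValuation p pr using (p^≢0; ⌊_/p^_⌋; k<p^k; vp-*; vp-pow; vp-Π!)
  open Basics e f using (Δ-cong; dot-e≤B; dot-f≤B)
  open Periodicity e f balanced using (Δ-periodic)
  open Digits e f p pr using (frac-shift-low)

  vp-Q : ∀ L n → B n < L →
         + vp p (ΠF (λ i → dot (e i) n !)) ℤ.- + vp p (ΠF (λ j → dot (f j) n !)) ≡ ΣZ 1 L (λ ℓ → Δfrac ℓ n)
  vp-Q L n B<L = begin
    + vp p (ΠF (λ i → dot (e i) n !)) ℤ.- + vp p (ΠF (λ j → dot (f j) n !))
      ≡⟨ cong₂ (λ u v → + u ℤ.- + v) (vp-Π! L (λ i → dot (e i) n) (λ i → below (dot-e≤B i n)))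
                                      (vp-Π! L (λ j → dot (f j) n) (λ j → below (dot-f≤B j n))) ⟩
    + ΣN 1 L (λ ℓ → ΣF (λ i → ⌊ dot (e i) n /p^ ℓ ⌋)) ℤ.- + ΣN 1 L (λ ℓ → ΣF (λ j → ⌊ dot (f j) n /p^ ℓ ⌋))
      ≡⟨ ΣN-ΣN≡ΣZ 1 L _ _ ⟩
    ΣZ 1 L (λ ℓ → Δ (p ^ ℓ) {{p^≢0 ℓ}} n)
      ≡⟨ ΣZ-cong 1 L (λ ℓ _ _ → Δ-periodic (p ^ ℓ) {{p^≢0 ℓ}} n) ⟩
    ΣZ 1 L (λ ℓ → Δfrac ℓ n) ∎
    where
    open ≡-Reasoning
    below : ∀ {x} → x ≤ B n → x < p ^ L
    below x≤B = ≤-<-trans x≤B (<-trans B<L (k<p^k L))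

  vpQ/g-expansion : ∀ t a m →
    vpQ/g (shift t a m) m ≡ (ΣZ 1 t (λ ℓ → Δfrac ℓ a) ℤ.+ η t a m) ℤ.- + μ m
  vpQ/g-expansion t a m = begin
    + vp p E ℤ.- + vp p (F * p ^ μ m)               ≡⟨ cong (λ v → + vp p E ℤ.- v) vp-F*g ⟩
    + vp p E ℤ.- (+ vp p F ℤ.+ + μ m)               ≡⟨ regroup (+ vp p E) (+ vp p F) (+ μ m) ⟩
    (+ vp p E ℤ.- + vp p F) ℤ.- + μ m               ≡⟨ cong (ℤ._- + μ m) (vp-Q L n (m≤n+m (suc (B n)) t)) ⟩
    ΣZ 1 (t + suc (B n)) Δn ℤ.- + μ m               ≡⟨ cong (ℤ._- + μ m) (ΣZ-split t (suc (B n)) 1 Δn) ⟩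
    (ΣZ 1 t Δn ℤ.+ ΣZ (t + 1) (suc (B n)) Δn) ℤ.- + μ m
      ≡⟨ cong (ℤ._- + μ m) (cong₂ ℤ._+_ head (cong (λ z → ΣZ z (suc (B n)) Δn) (+-comm t 1))) ⟩
    (ΣZ 1 t (λ ℓ → Δfrac ℓ a) ℤ.+ η t a m) ℤ.- + μ m ∎
    where
    open ≡-Reasoning
    n : Fin d → ℕ
    n = shift t a m
    L : ℕ
    L = t + suc (B n)
    E F : ℕ
    E = ΠF (λ i → dot (e i) n !)
    F = ΠF (λ j → dot (f j) n !)
    Δn : ℕ → ℤ
    Δn ℓ = Δfrac ℓ n
    vp-F*g : + vp p (F * p ^ μ m) ≡ + vp p F ℤ.+ + μ m
    vp-F*g = trans (cong +_ (trans (vp-* F (p ^ μ m) F≢0 (≢-nonZero⁻¹ _ {{p^≢0 (μ m)}}))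
                                   (cong (_+_ (vp p F)) (vp-pow (μ m)))))
                   (ℤP.pos-+ (vp p F) (μ m))
      where
      F≢0 : F ≢ 0
      F≢0 = ΠF≢0 (λ j → dot (f j) n !) (λ j → factorial≢0 (dot (f j) n))
    regroup : ∀ x y z → x ℤ.- (y ℤ.+ z) ≡ (x ℤ.- y) ℤ.- z
    regroup = ℤSolver.solve-∀
    -- the first t terms only see the digits of a
    head : ΣZ 1 t Δn ≡ ΣZ 1 t (λ ℓ → Δfrac ℓ a)
    head = ΣZ-cong 1 t (λ ℓ _ ℓ<1+t → Δ-cong (p ^ ℓ) {{p^≢0 ℓ}} (frac-shift-low t a m ℓ (≤-pred ℓ<1+t)))

-- Main theorem: with t = s + 1, η_t(a,m) ≥ μ(m), and the expansion of v_p(Q(n)/g(m)) then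
-- exceeds Σ_{ℓ ≤ t} Δ({a/p^ℓ}) by η_t(a,m) − μ(m) ≥ 0.
lemma14 : ∀ {d q₁ q₂ : ℕ} (e : Fin q₁ → Fin d → ℕ) (f : Fin q₂ → Fin d → ℕ) →
    (∀ i → ¬ (∀ k → e i k ≡ 0)) →
    (∀ j → ¬ (∀ k → f j k ≡ 0)) →
    (∀ i j → ¬ (∀ k → e i k ≡ f j k)) →
    (∀ k → ΣF (λ i → e i k) ≡ ΣF (λ j → f j k)) →
    (∀ (N : ℕ) .{{_ : NonZero N}} (n : Fin d → ℕ) → (∀ k → n k ≤ N) →
      0ℤ ℤ.≤ Setup.Δ e f N n) →
    (∀ (N : ℕ) .{{_ : NonZero N}} (n : Fin d → ℕ) → Setup.In𝒟 e f N n →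
      1ℤ ℤ.≤ Setup.Δ e f N n) →
    (p : ℕ) (pr : Prime p) (s : ℕ) (a : Fin d → ℕ) → (∀ k → a k < p ^ suc s) →
    (m : Fin d → ℕ) →
    (+ Setup.AtPrime.μ e f p pr m ℤ.≤ Setup.AtPrime.η e f p pr (suc s) a m)
    × (ΣZ 1 (suc s) (λ ℓ → Setup.AtPrime.Δfrac e f p pr ℓ a)
        ℤ.≤ Setup.AtPrime.vpQ/g e f p pr (Setup.AtPrime.shift e f p pr (suc s) a m) m)
lemma14 e f _ _ _ balanced Δ≥0 Δ≥1 p pr s a a<p^t m = μ≤η t a m a<p^t , valuation-bound
  where
  open Setup.AtPrime e f p pr
  open Dominance e f Δ≥0 Δ≥1 p pr using (μ≤η)
  open Expansion e f balanced p pr using (vpQ/g-expansion)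
  t : ℕ
  t = suc s
  S : ℤ
  S = ΣZ 1 t (λ ℓ → Δfrac ℓ a)
  valuation-bound : S ℤ.≤ vpQ/g (shift t a m) m
  valuation-bound = begin
    S                                    ≡⟨ sym (ℤP.+-identityʳ S) ⟩
    S ℤ.+ 0ℤ                             ≤⟨ ℤP.+-monoʳ-≤ S (ℤP.i≤j⇒0≤j-i (μ≤η t a m a<p^t)) ⟩
    S ℤ.+ (η t a m ℤ.- + μ m)            ≡⟨ sym (ℤP.+-assoc S (η t a m) (ℤ.- + μ m)) ⟩
    (S ℤ.+ η t a m) ℤ.- + μ m            ≡⟨ sym (vpQ/g-expansion t a m) ⟩
    vpQ/g (shift t a m) m                ∎
    where open ℤP.≤-Reasoning
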